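{- Let $J$ be a set of unit-time, unit-consumption jobs with acyclic precedence graph $G$, let $P$ be a critical path of $G$ and $m^*_P$ the size of a maximum matching in the bipartite independence graph $\widetilde{G}_P$. For any $M\in\mathbb{N}$ with $M\ge|P|$, the optimal objective value satisfies $F^*(M)\le 2(M-|P|)+|P|+m^*_P$.
   Context: Schedules are $x\in\mathbb{N}^J$, feasible if $x_i+1\le x_j$ for each arc $(i,j)$ of $G$ and $C_{max}(x)=\max_i(x_i+1)\le M$. With $r_\tau(x)=|\{i:x_i=\tau\}|$, $F(x)=\sum_{\tau=0}^{C_{max}(x)-1}\min(2,r_\tau(x))$ and $F^*(M)$ is the maximum of $F$ over feasible schedules for deadline $M$. A critical path is a path of $G$ with the maximum number of jobs. Two distinct jobs are independent if there is no directed path between them in $G$. $\widetilde{G}_P$ is the bipartite graph with parts $P$ and $J\setminus P$ whose edges join independent pairs $i\in P$, $j\in J\setminus P$. -}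

module Defs where

open import Data.Nat using (ℕ; zero; suc; _+_; _*_; _∸_; _≤_; _⊔_; _⊓_; _≟_)
open import Data.Fin using (Fin)
open import Data.List using (List; []; _∷_; length; map; foldr; upTo; allFin; filter)
open import Data.Nat.ListAction using (sum)
open import Data.List.Membership.Propositional using (_∈_; _∉_)
open import Data.List.Relation.Unary.All using (All)
open import Data.List.Relation.Unary.Unique.Propositional using (Unique)
open import Data.Product using (_×_; _,_; proj₁; proj₂)
open import Data.Empty using (⊥)
open import Data.Unit using (⊤)
open import Relation.Nullary using (¬_)
open import Relation.Binary.PropositionalEquality using (_≡_)
open import Relation.Binary.Construct.Closure.Transitive using (TransClosure)

-- Jobs are J = Fin n; the precedence graph G is given by its arc relation.
Graph : ℕ → Set₁
Graph n = Fin n → Fin n → Set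

Reach : ∀ {n} → Graph n → Fin n → Fin n → Set
Reach G = TransClosure G

Acyclic : ∀ {n} → Graph n → Set
Acyclic G = ∀ i → ¬ Reach G i i

IsChain : ∀ {n} → Graph n → List (Fin n) → Set
IsChain G [] = ⊥
IsChain G (i ∷ []) = ⊤
IsChain G (i ∷ j ∷ p) = G i j × IsChain G (j ∷ p)

IsCriticalPath : ∀ {n} → Graph n → List (Fin n) → Set
IsCriticalPath G P = IsChain G P × (∀ Q → IsChain G Q → length Q ≤ length P)

Independent : ∀ {n} → Graph n → Fin n → Fin n → Set
Independent G i j = ¬ (i ≡ j) × ¬ Reach G i j × ¬ Reach G j i

-- matching in the bipartite graph G̃_P (parts P and J∖P, edges = independent pairs),
-- as a list of edges (i , j) with i ∈ P, j ∉ P, pairwise disjoint.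
IsMatchingP : ∀ {n} → Graph n → List (Fin n) → List (Fin n × Fin n) → Set
IsMatchingP G P μ =
  All (λ e → proj₁ e ∈ P × proj₂ e ∉ P × Independent G (proj₁ e) (proj₂ e)) μ
  × Unique (map proj₁ μ) × Unique (map proj₂ μ)

IsMaximumMatchingP : ∀ {n} → Graph n → List (Fin n) → List (Fin n × Fin n) → Set
IsMaximumMatchingP G P μ = IsMatchingP G P μ × (∀ ν → IsMatchingP G P ν → length ν ≤ length μ)

Schedule : ℕ → Set
Schedule n = Fin n → ℕ

Cmax : ∀ {n} → Schedule n → ℕ
Cmax {n} x = foldr _⊔_ 0 (map (λ i → suc (x i)) (allFin n))

Feasible : ∀ {n} → Graph n → ℕ → Schedule n → Set
Feasible G M x = (∀ i j → G i j → suc (x i) ≤ x j) × Cmax x ≤ M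

r : ∀ {n} → Schedule n → ℕ → ℕ
r {n} x τ = length (filter (λ i → x i ≟ τ) (allFin n))

F : ∀ {n} → Schedule n → ℕ
F x = sum (map (λ τ → 2 ⊓ r x τ) (upTo (Cmax x)))

{-# OPTIONS --safe #-}
module Submission where

-- Fix a feasible schedule x. The jobs of the path P start at pairwise distinct times, and two
-- jobs starting at the same time are independent, so pairing each job of P with some job outside
-- P that starts together with it (when there is one) gives a matching ν of G̃_P. Every time slot
-- τ < Cmax contributes min(2, r_τ) ≤ 2 to F, and at most 1 when it hosts a job of P left
-- unpaired, since that job then runs alone. Summing, F + |P| ≤ 2 Cmax + |ν| ≤ 2 M + m*_P.

open import Defs
open import Data.Nat using (ℕ; suc; _+_; _*_; _∸_; _≤_; _<_; _⊓_; _⊔_; _≟_; z≤n; s≤s)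
open import Data.Nat.Properties
open import Algebra.Properties.CommutativeSemigroup +-commutativeSemigroup using (interchange)
open import Data.Nat.Solver using (module +-*-Solver)
open import Data.Nat.ListAction using (sum)
open import Data.Fin as Fin using (Fin)
open import Data.List using (List; []; _∷_; length; map; foldr; upTo; allFin; filter)
open import Data.List.Properties using (length-upTo; map-cong; filter-none; filter-accept; filter-reject)
open import Data.List.Membership.Propositional using (_∈_; _∉_; find)
open import Data.List.Membership.Propositional.Properties
  using (∈-filter⁺; ∈-filter⁻; ∈-upTo⁺; ∈-allFin; ∈-map⁺; ∈-length)
open import Data.List.Relation.Unary.All as All using (All; []; _∷_)
open import Data.List.Relation.Unary.Any using (here; there; any?)
open import Data.List.Relation.Unary.All.Properties using (¬Any⇒All¬)
open import Data.List.Relation.Unary.AllPairs as AllPairs using (AllPairs; []; _∷_)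
import Data.List.Relation.Unary.AllPairs.Properties as AllPairs
open import Data.List.Relation.Unary.Unique.Propositional using (Unique)
open import Data.List.Relation.Unary.Unique.Propositional.Properties using (upTo⁺; allFin⁺; filter⁺)
open import Data.Product as Product using (_×_; _,_; proj₁; proj₂; ∃)
open import Data.Empty using (⊥-elim)
open import Function using (_∘′_)
open import Relation.Nullary using (¬_; Dec; yes; no; ¬?)
open import Relation.Nullary.Decidable using (_×-dec_)
open import Relation.Binary.PropositionalEquality
  using (_≡_; refl; sym; trans; cong; cong₂; subst; subst₂; module ≡-Reasoning)
open import Relation.Binary.Construct.Closure.Transitive using ([_]; _∷_)

module _ {A : Set} where

  sum-map-+ : (f g : A → ℕ) (L : List A) →
              sum (map (λ a → f a + g a) L) ≡ sum (map f L) + sum (map g L)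
  sum-map-+ f g [] = refl
  sum-map-+ f g (a ∷ L) rewrite sum-map-+ f g L = interchange (f a) (g a) _ _

  sum-map-const : (c : ℕ) (L : List A) → sum (map (λ _ → c) L) ≡ c * length L
  sum-map-const c [] = sym (*-zeroʳ c)
  sum-map-const c (a ∷ L) rewrite sum-map-const c L = sym (*-suc c (length L))

  sum-map-mono : {f g : A → ℕ} → (∀ a → f a ≤ g a) → (L : List A) →
                 sum (map f L) ≤ sum (map g L)
  sum-map-mono f≤g [] = z≤n
  sum-map-mono f≤g (a ∷ L) = +-mono-≤ (f≤g a) (sum-map-mono f≤g L)

  length≤1 : {L : List A} → Unique L → (∀ {a b} → a ∈ L → b ∈ L → a ≡ b) →
             length L ≤ 1
  length≤1 {[]} _ _ = z≤n
  length≤1 {a ∷ []} _ _ = s≤s z≤n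
  length≤1 {a ∷ b ∷ L} ((a≢b ∷ _) ∷ _) all-equal =
    ⊥-elim (a≢b (all-equal (here refl) (there (here refl))))

  Increasing : (A → ℕ) → List A → Set
  Increasing f = AllPairs (λ a b → f a < f b)

  Increasing⇒Unique : {f : A → ℕ} {L : List A} → Increasing f L → Unique L
  Increasing⇒Unique = AllPairs.map (λ fa<fb a≡b → <-irrefl (cong _ a≡b) fa<fb)

  Increasing⇒Unique-map : {B : Set} {g : A → B} {f : B → ℕ} {L : List A} →
                          Increasing (λ a → f (g a)) L → Unique (map g L)
  Increasing⇒Unique-map {f = f} =
    AllPairs.map⁺ ∘′ AllPairs.map (λ fga<fgb ga≡gb → <-irrefl (cong f ga≡gb) fga<fgb)

  Increasing⇒injective : {f : A → ℕ} {L : List A} → Increasing f L →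
                         ∀ {a b} → a ∈ L → b ∈ L → f a ≡ f b → a ≡ b
  Increasing⇒injective _ (here refl) (here refl) _ = refl
  Increasing⇒injective (a< ∷ _) (here refl) (there b∈) fa≡fb =
    ⊥-elim (<-irrefl fa≡fb (All.lookup a< b∈))
  Increasing⇒injective (b< ∷ _) (there a∈) (here refl) fa≡fb =
    ⊥-elim (<-irrefl (sym fa≡fb) (All.lookup b< a∈))
  Increasing⇒injective (_ ∷ inc) (there a∈) (there b∈) fa≡fb =
    Increasing⇒injective inc a∈ b∈ fa≡fb

  Increasing-cong : {f g : A → ℕ} {L : List A} → (∀ {a} → a ∈ L → f a ≡ g a) →
                    Increasing f L → Increasing g L
  Increasing-cong f≡g [] = []
  Increasing-cong f≡g (a< ∷ inc) =
    All.tabulate (λ b∈ → subst₂ _<_ (f≡g (here refl)) (f≡g (there b∈)) (All.lookup a< b∈))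
    ∷ Increasing-cong (λ a∈ → f≡g (there a∈)) inc

δ : ℕ → ℕ → ℕ
δ u v with u ≟ v
... | yes _ = 1
... | no _ = 0

δ-≡ : ∀ {u v} → u ≡ v → δ u v ≡ 1
δ-≡ {u} {v} u≡v with u ≟ v
... | yes _ = refl
... | no u≢v = ⊥-elim (u≢v u≡v)

δ-≢ : ∀ {u v} → ¬ u ≡ v → δ u v ≡ 0
δ-≢ {u} {v} u≢v with u ≟ v
... | yes u≡v = ⊥-elim (u≢v u≡v)
... | no _ = refl

sum-δ-∉ : ∀ {v T} → v ∉ T → sum (map (δ v) T) ≡ 0
sum-δ-∉ {T = []} _ = refl
sum-δ-∉ {T = τ ∷ T} v∉ rewrite δ-≢ (λ v≡τ → v∉ (here v≡τ)) =
  sum-δ-∉ (λ v∈ → v∉ (there v∈))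

sum-δ-∈ : ∀ {v T} → Unique T → v ∈ T → sum (map (δ v) T) ≡ 1
sum-δ-∈ {v} (v∉T ∷ _) (here refl)
  rewrite δ-≡ (refl {x = v}) | sum-δ-∉ (λ v∈T → All.lookup v∉T v∈T refl) = refl
sum-δ-∈ {v} (τ∉T ∷ T-unique) (there v∈T)
  rewrite δ-≢ (λ v≡τ → All.lookup τ∉T v∈T (sym v≡τ)) = sum-δ-∈ T-unique v∈T

module _ {A : Set} where

  multiplicity : (A → ℕ) → List A → ℕ → ℕ
  multiplicity f L τ = length (filter (λ a → f a ≟ τ) L)

  multiplicity-∷ : ∀ f a L τ → multiplicity f (a ∷ L) τ ≡ δ (f a) τ + multiplicity f L τ
  multiplicity-∷ f a L τ = by-cases (f a ≟ τ)
    where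
    by-cases : Dec (f a ≡ τ) → multiplicity f (a ∷ L) τ ≡ δ (f a) τ + multiplicity f L τ
    by-cases (yes fa≡τ) = trans (cong length (filter-accept (λ a → f a ≟ τ) {xs = L} fa≡τ))
                                (cong (_+ multiplicity f L τ) (sym (δ-≡ fa≡τ)))
    by-cases (no fa≢τ) = trans (cong length (filter-reject (λ a → f a ≟ τ) {xs = L} fa≢τ))
                               (cong (_+ multiplicity f L τ) (sym (δ-≢ fa≢τ)))

  sum-multiplicity : ∀ {f T} → Unique T → ∀ {L} → All (λ a → f a ∈ T) L →
                     sum (map (multiplicity f L) T) ≡ length L
  sum-multiplicity {T = T} _ [] = sum-map-const 0 T
  sum-multiplicity {f} {T} T-unique {a ∷ L} (fa∈T ∷ fL⊆T) = begin
    sum (map (multiplicity f (a ∷ L)) T)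
      ≡⟨ cong sum (map-cong (multiplicity-∷ f a L) T) ⟩
    sum (map (λ τ → δ (f a) τ + multiplicity f L τ) T)
      ≡⟨ sum-map-+ (δ (f a)) (multiplicity f L) T ⟩
    sum (map (δ (f a)) T) + sum (map (multiplicity f L) T)
      ≡⟨ cong₂ _+_ (sum-δ-∈ T-unique fa∈T) (sum-multiplicity T-unique fL⊆T) ⟩
    suc (length L) ∎
    where open ≡-Reasoning

  multiplicity≤1 : ∀ {f L τ} → Unique L →
                   (∀ {a b} → a ∈ L → b ∈ L → f a ≡ τ → f b ≡ τ → a ≡ b) →
                   multiplicity f L τ ≤ 1
  multiplicity≤1 {f} {L} {τ} L-unique fibre-trivial =
    length≤1 (filter⁺ fibre? L-unique) λ a∈ b∈ →
    let a∈L , fa≡τ = ∈-filter⁻ fibre? a∈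
        b∈L , fb≡τ = ∈-filter⁻ fibre? b∈
    in fibre-trivial a∈L b∈L fa≡τ fb≡τ
    where fibre? = λ a → f a ≟ τ

  ∈⇒1≤multiplicity : ∀ {f L a τ} → a ∈ L → f a ≡ τ → 1 ≤ multiplicity f L τ
  ∈⇒1≤multiplicity {f} {τ = τ} a∈L fa≡τ =
    ∈-length (∈-filter⁺ (λ a → f a ≟ τ) a∈L fa≡τ)

∈⇒≤foldr-⊔ : ∀ {v L} → v ∈ L → v ≤ foldr _⊔_ 0 L
∈⇒≤foldr-⊔ (here refl) = m≤m⊔n _ _
∈⇒≤foldr-⊔ {L = u ∷ L} (there v∈L) = ≤-trans (∈⇒≤foldr-⊔ v∈L) (m≤n⊔m u _)

start<Cmax : ∀ {n} (x : Schedule n) i → x i < Cmax x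
start<Cmax x i = ∈⇒≤foldr-⊔ (∈-map⁺ (λ i → suc (x i)) (∈-allFin i))

module FeasibleSchedule {n} {G : Graph n} {x : Schedule n}
                        (precedence : ∀ i j → G i j → suc (x i) ≤ x j) where

  Reach⇒< : ∀ {i j} → Reach G i j → x i < x j
  Reach⇒< [ i→j ] = precedence _ _ i→j
  Reach⇒< (i→k ∷ k⇝j) = <-trans (precedence _ _ i→k) (Reach⇒< k⇝j)

  IsChain⇒Increasing : ∀ {P} → IsChain G P → Increasing x P
  IsChain⇒Increasing {i ∷ []} _ = [] ∷ []
  IsChain⇒Increasing {i ∷ j ∷ P} (i→j , chain) with IsChain⇒Increasing chain
  ... | j< ∷ inc = (precedence _ _ i→j ∷ All.map (<-trans (precedence _ _ i→j)) j<) ∷ j< ∷ inc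

  simultaneous⇒Independent : ∀ {i j} → ¬ i ≡ j → x i ≡ x j → Independent G i j
  simultaneous⇒Independent i≢j xi≡xj =
    i≢j , (λ i⇝j → <-irrefl xi≡xj (Reach⇒< i⇝j))
        , (λ j⇝i → <-irrefl (sym xi≡xj) (Reach⇒< j⇝i))

  module OnPath (P : List (Fin n)) (P-increasing : Increasing x P) where

    open import Data.List.Membership.DecPropositional (Fin._≟_ {n}) using (_∈?_)

    partner? : ∀ i j → Dec (x j ≡ x i × j ∉ P)
    partner? i j = x j ≟ x i ×-dec ¬? (j ∈? P)

    partners : Fin n → List (Fin n)
    partners i = filter (partner? i) (allFin n)

    ∈-partners⁻ : ∀ {i j} → j ∈ partners i → x j ≡ x i × j ∉ P
    ∈-partners⁻ {i} j∈ = proj₂ (∈-filter⁻ (partner? i) {xs = allFin n} j∈)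

    edgeStart : Fin n × Fin n → ℕ
    edgeStart e = x (proj₁ e)

    pairUp : List (Fin n) → List (Fin n × Fin n)
    pairUp [] = []
    pairUp (i ∷ Q) with partners i
    ... | [] = pairUp Q
    ... | j ∷ _ = (i , j) ∷ pairUp Q

    ∈-pairUp⁻ : ∀ {Q e} → e ∈ pairUp Q → proj₁ e ∈ Q × proj₂ e ∈ partners (proj₁ e)
    ∈-pairUp⁻ {i ∷ Q} e∈ with partners i in eq
    ... | [] = Product.map₁ there (∈-pairUp⁻ e∈)
    ... | j ∷ _ with e∈
    ...   | here refl = here refl , subst (j ∈_) (sym eq) (here refl)
    ...   | there e∈′ = Product.map₁ there (∈-pairUp⁻ e∈′)

    ∈-pairUp⁺ : ∀ {Q i j} → i ∈ Q → j ∈ partners i → ∃ λ j′ → (i , j′) ∈ pairUp Q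
    ∈-pairUp⁺ {i ∷ Q} (here refl) j∈ with partners i
    ... | j′ ∷ _ = j′ , here refl
    ∈-pairUp⁺ {k ∷ Q} (there i∈) j∈ with partners k
    ... | [] = ∈-pairUp⁺ i∈ j∈
    ... | _ ∷ _ = Product.map₂ there (∈-pairUp⁺ i∈ j∈)

    pairUp-increasing : ∀ {Q} → Increasing x Q → Increasing edgeStart (pairUp Q)
    pairUp-increasing [] = []
    pairUp-increasing {i ∷ Q} (i< ∷ inc) with partners i
    ... | [] = pairUp-increasing inc
    ... | _ ∷ _ =
      All.tabulate (λ e∈ → All.lookup i< (proj₁ (∈-pairUp⁻ e∈))) ∷ pairUp-increasing inc

    ν : List (Fin n × Fin n)
    ν = pairUp P

    ν-matching : IsMatchingP G P ν
    ν-matching =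
      All.tabulate edge , Increasing⇒Unique-map ν-increasing₁ , Increasing⇒Unique-map ν-increasing₂
      where
      ν-increasing₁ : Increasing edgeStart ν
      ν-increasing₁ = pairUp-increasing P-increasing

      ν-increasing₂ : Increasing (λ e → x (proj₂ e)) ν
      ν-increasing₂ =
        Increasing-cong (λ e∈ → sym (proj₁ (∈-partners⁻ (proj₂ (∈-pairUp⁻ {P} e∈))))) ν-increasing₁

      edge : ∀ {e} → e ∈ ν → proj₁ e ∈ P × proj₂ e ∉ P × Independent G (proj₁ e) (proj₂ e)
      edge e∈ with ∈-pairUp⁻ e∈
      ... | i∈P , j∈ with ∈-partners⁻ j∈
      ...   | xj≡xi , j∉P =
        i∈P , j∉P , simultaneous⇒Independent (λ { refl → j∉P i∈P }) (sym xj≡xi)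

    P-multiplicity≤1 : ∀ τ → multiplicity x P τ ≤ 1
    P-multiplicity≤1 τ = multiplicity≤1 (Increasing⇒Unique P-increasing)
      (λ a∈ b∈ xa≡τ xb≡τ → Increasing⇒injective P-increasing a∈ b∈ (trans xa≡τ (sym xb≡τ)))

    unpartnered⇒r≤1 : ∀ {i} → i ∈ P → partners i ≡ [] → r x (x i) ≤ 1
    unpartnered⇒r≤1 {i} i∈P no-partner = multiplicity≤1 (allFin⁺ n)
      (λ _ _ xa≡xi xb≡xi → trans (only-i xa≡xi) (sym (only-i xb≡xi)))
      where
      only-i : ∀ {k} → x k ≡ x i → k ≡ i
      only-i {k} xk≡xi with k ∈? P
      ... | yes k∈P = Increasing⇒injective P-increasing k∈P i∈P xk≡xi
      ... | no k∉P
          with subst (k ∈_) no-partner (∈-filter⁺ (partner? i) (∈-allFin k) (xk≡xi , k∉P))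
      ...   | ()

    partnered⇒1≤ν-multiplicity : ∀ {i j} → i ∈ P → j ∈ partners i →
                                 1 ≤ multiplicity edgeStart ν (x i)
    partnered⇒1≤ν-multiplicity i∈P j∈ = ∈⇒1≤multiplicity (proj₂ (∈-pairUp⁺ i∈P j∈)) refl

    -- min(2, r_τ) ≤ 2 − [a job of P starts at τ] + [a matched job of P starts at τ],
    -- with the subtraction moved to the left.
    slot-bound : ∀ τ → 2 ⊓ r x τ + multiplicity x P τ ≤ 2 + multiplicity edgeStart ν τ
    slot-bound τ with any? (λ i → x i ≟ τ) P
    ... | no none rewrite filter-none (λ i → x i ≟ τ) (¬Any⇒All¬ P none) =
      +-mono-≤ (m⊓n≤m 2 _) z≤n
    ... | yes some with find some
    ...   | i , i∈P , refl with partners i in eq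
    ...     | [] = ≤-trans (+-mono-≤ (≤-trans (m⊓n≤n 2 _) (unpartnered⇒r≤1 i∈P eq))
                                     (P-multiplicity≤1 _))
                           (m≤m+n 2 _)
    ...     | j ∷ _ = +-mono-≤ (m⊓n≤m 2 _) (≤-trans (P-multiplicity≤1 _)
                        (partnered⇒1≤ν-multiplicity i∈P (subst (j ∈_) (sym eq) (here refl))))

    F+length≤2Cmax+matched : F x + length P ≤ 2 * Cmax x + length ν
    F+length≤2Cmax+matched = begin
      F x + length P
        ≡⟨ cong (F x +_) (sum-multiplicity {f = x} (upTo⁺ (Cmax x)) {P}
                                           (All.tabulate (λ {i} _ → slot i))) ⟨
      sum (map (λ τ → 2 ⊓ r x τ) T) + sum (map (multiplicity x P) T)
        ≡⟨ sum-map-+ (λ τ → 2 ⊓ r x τ) (multiplicity x P) T ⟨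
      sum (map (λ τ → 2 ⊓ r x τ + multiplicity x P τ) T)
        ≤⟨ sum-map-mono slot-bound T ⟩
      sum (map (λ τ → 2 + multiplicity edgeStart ν τ) T)
        ≡⟨ sum-map-+ (λ _ → 2) (multiplicity edgeStart ν) T ⟩
      sum (map (λ _ → 2) T) + sum (map (multiplicity edgeStart ν) T)
        ≡⟨ cong₂ _+_ (trans (sum-map-const 2 T) (cong (2 *_) (length-upTo (Cmax x))))
                     (sum-multiplicity {f = λ e → x (proj₁ e)} (upTo⁺ (Cmax x)) {ν}
                                       (All.tabulate (λ {e} _ → slot (proj₁ e)))) ⟩
      2 * Cmax x + length ν ∎
      where
      open ≤-Reasoning
      T : List ℕ
      T = upTo (Cmax x)
      slot : ∀ i → x i ∈ T
      slot i = ∈-upTo⁺ (start<Cmax x i)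

deadline-arithmetic : ∀ {f p c m M} → f + p ≤ 2 * c + m → c ≤ M → p ≤ M →
                      f ≤ 2 * (M ∸ p) + p + m
deadline-arithmetic {f} {p} {c} {m} {M} f+p≤ c≤M p≤M = +-cancelʳ-≤ p f _ (begin
  f + p                       ≤⟨ f+p≤ ⟩
  2 * c + m                   ≤⟨ +-monoˡ-≤ m (*-monoʳ-≤ 2 c≤M) ⟩
  2 * M + m                   ≡⟨ cong (λ k → 2 * k + m) (m∸n+n≡m p≤M) ⟨
  2 * (M ∸ p + p) + m         ≡⟨ regroup (M ∸ p) p m ⟩
  2 * (M ∸ p) + p + m + p     ∎)
  where
  open ≤-Reasoning
  open +-*-Solver
  regroup : ∀ d p m → 2 * (d + p) + m ≡ 2 * d + p + m + p
  regroup = solve 3 (λ d p m → con 2 :* (d :+ p) :+ m := con 2 :* d :+ p :+ m :+ p) refl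

lemma4 : (n : ℕ) (G : Graph n) → Acyclic G →
         (P : List (Fin n)) → IsCriticalPath G P →
         (μ : List (Fin n × Fin n)) → IsMaximumMatchingP G P μ →
         (M : ℕ) → length P ≤ M →
         (x : Schedule n) → Feasible G M x →
         F x ≤ 2 * (M ∸ length P) + length P + length μ
lemma4 n G _ P (P-chain , _) μ (_ , μ-maximum) M |P|≤M x (precedence , Cmax≤M) =
  deadline-arithmetic
    (≤-trans F+length≤2Cmax+matched (+-monoʳ-≤ (2 * Cmax x) (μ-maximum ν ν-matching)))
    Cmax≤M |P|≤M
  where
  open FeasibleSchedule precedence
  open OnPath P (IsChain⇒Increasing P-chain)
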